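{- If $T$ is a superperfect subtree of $(\omega)^{<\omega}$, then $\{\operatorname{osc}(s,t): s,t\in T,\ s\neq t\}=\omega$.
   Context: $(\omega)^{<\omega}$ is the set of strictly increasing functions from some $n<\omega$ to $\omega$, a tree under the initial-segment relation $\sqsubseteq$; a subtree is a subset closed under initial segments. A node $t$ of a subtree $T$ is $\infty$-splitting if for every $k$ there is $u\in T$ with $t\sqsubseteq u$ and $u(|t|)>k$; $T$ is superperfect if every node of $T$ has an $\infty$-splitting extension in $T$. For finite increasing sequences $s,t$, $\operatorname{osc}(s,t)=|\{n<\omega: s(n)\le t(n)\text{ and }s(n+1)>t(n+1)\}|$, where only $n$ with $n+1$ in the domain of both $s$ and $t$ are counted. (The paper writes the conclusion as $\operatorname{osc}''[T]^2=\omega$.) -}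

module Defs where

open import Data.Nat using (ℕ; zero; suc; _+_; _≤_; _<_; _≤?_; _<?_)
open import Data.List using (List; []; _∷_; _++_; length)
open import Data.Maybe using (Maybe; just; nothing)
open import Data.Product using (Σ; ∃; _×_; _,_)
open import Data.Bool using (Bool; true; false; _∧_)
open import Relation.Nullary.Decidable using (⌊_⌋)
open import Relation.Binary.PropositionalEquality using (_≡_)

-- Strictly increasing finite sequences (elements of (ω)^{<ω}), as lists.
data Increasing : List ℕ → Set where
  inc-[] : Increasing []
  inc-[x] : ∀ {x} → Increasing (x ∷ [])
  inc-∷ : ∀ {x y s} → x < y → Increasing (y ∷ s) → Increasing (x ∷ y ∷ s)

_⊑_ : List ℕ → List ℕ → Set
s ⊑ u = Σ (List ℕ) λ v → s ++ v ≡ u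

at : List ℕ → ℕ → Maybe ℕ
at [] _ = nothing
at (x ∷ u) zero = just x
at (x ∷ u) (suc n) = at u n

record Subtree (T : List ℕ → Set) : Set where
  field
    increasing : ∀ s → T s → Increasing s
    closed : ∀ s u → s ⊑ u → T u → T s

InfSplitting : (List ℕ → Set) → List ℕ → Set
InfSplitting T t = ∀ (k : ℕ) → Σ (List ℕ) λ u → T u × t ⊑ u ×
  Σ ℕ λ x → at u (length t) ≡ just x × k < x

Superperfect : (List ℕ → Set) → Set
Superperfect T = ∀ t → T t → Σ (List ℕ) λ u → T u × t ⊑ u × InfSplitting T u

-- osc(s,t) = |{n : s(n) ≤ t(n) and s(n+1) > t(n+1)}|, counting only n with
-- n+1 in the domain of both s and t
osc : List ℕ → List ℕ → ℕ
osc (a ∷ b ∷ s) (c ∷ d ∷ t) =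
  (if ⌊ a ≤? c ⌋ ∧ ⌊ d <? b ⌋ then 1 else 0) + osc (b ∷ s) (d ∷ t)
  where
    if_then_else_ : Bool → ℕ → ℕ → ℕ
    if true then x else y = x
    if false then x else y = y
osc _ _ = 0

module Submission where

-- Call a pair (ℓ, h) of ∞-splitting nodes of T an (i, j)-pair when h is longer
-- than ℓ, the last entry of ℓ is at most the entry of h at the same position,
-- osc ℓ h ≡ i and osc h ℓ ≡ j.  The whole proof is the step
--
--     an (i, j)-pair (ℓ, h) yields a (j, i + 1)-pair (h, q):
--
-- extend ℓ by an immediate successor x exceeding every entry of h and continue
-- to an ∞-splitting node q longer than h.  Since T consists of increasing
-- sequences, q lies entirely above h after position |ℓ|, so comparing q with h
-- adds exactly one oscillation (at the junction |ℓ| - 1) to osc ℓ h, while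
-- comparing h with q adds none to osc h ℓ.  Starting from a (0, 0)-pair and
-- applying the step twice per round gives a (k, k)-pair for every k.

open import Defs
open import Data.Nat using (ℕ; zero; suc; _+_; _≤_; _<_; _⊔_; _≤?_; _<?_; z≤n; s≤s)
open import Data.Nat.Properties
  using (≤-refl; ≤-reflexive; ≤-trans; <-trans; <-≤-trans; <⇒≤; <⇒≱; ≤⇒≯;
         m≤m⊔n; m≤n⊔m; m≤n+m; m+1+n≢m; suc-injective)
open import Data.List using (List; []; _∷_; _++_; length)
open import Data.List.Properties using (++-assoc; length-++)
open import Data.List.Relation.Unary.All as All using (All; []; _∷_)
open import Data.List.Relation.Unary.All.Properties using (++⁻ˡ; ++⁻ʳ)
open import Data.Maybe using (just)
open import Data.Product using (Σ; _×_; _,_)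
open import Relation.Nullary using (yes; no; contradiction)
open import Relation.Binary.PropositionalEquality
  using (_≡_; _≢_; refl; sym; trans; cong; subst; module ≡-Reasoning)

open ≡-Reasoning

osc-cross : ∀ a b c d s t → a ≤ c → d < b →
  osc (a ∷ b ∷ s) (c ∷ d ∷ t) ≡ suc (osc (b ∷ s) (d ∷ t))
osc-cross a b c d s t a≤c d<b with a ≤? c | d <? b
... | yes _ | yes _ = refl
... | no a≰c | _ = contradiction a≤c a≰c
... | yes _ | no d≮b = contradiction d<b d≮b

osc-skipˡ : ∀ a b c d s t → c < a →
  osc (a ∷ b ∷ s) (c ∷ d ∷ t) ≡ osc (b ∷ s) (d ∷ t)
osc-skipˡ a b c d s t c<a with a ≤? c
... | yes a≤c = contradiction a≤c (<⇒≱ c<a)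
... | no _ = refl

osc-skipʳ : ∀ a b c d s t → b ≤ d →
  osc (a ∷ b ∷ s) (c ∷ d ∷ t) ≡ osc (b ∷ s) (d ∷ t)
osc-skipʳ a b c d s t b≤d with a ≤? c | d <? b
... | _ | yes d<b = contradiction d<b (≤⇒≯ b≤d)
... | yes _ | no _ = refl
... | no _ | no _ = refl

osc-tail-cong : ∀ a b c d s t s′ t′ →
  osc (b ∷ s) (d ∷ t) ≡ osc (b ∷ s′) (d ∷ t′) →
  osc (a ∷ b ∷ s) (c ∷ d ∷ t) ≡ osc (a ∷ b ∷ s′) (c ∷ d ∷ t′)
osc-tail-cong a b c d s t s′ t′ e with a ≤? c | d <? b
... | yes _ | yes _ = cong suc e
... | yes _ | no _ = e
... | no _ | _ = e

osc-tail-suc : ∀ a b c d s t s′ t′ →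
  osc (b ∷ s) (d ∷ t) ≡ suc (osc (b ∷ s′) (d ∷ t′)) →
  osc (a ∷ b ∷ s) (c ∷ d ∷ t) ≡ suc (osc (a ∷ b ∷ s′) (c ∷ d ∷ t′))
osc-tail-suc a b c d s t s′ t′ e with a ≤? c | d <? b
... | yes _ | yes _ = cong suc e
... | yes _ | no _ = e
... | no _ | _ = e

osc-refl : ∀ s → osc s s ≡ 0
osc-refl [] = refl
osc-refl (a ∷ []) = refl
osc-refl (a ∷ b ∷ s) = trans (osc-skipʳ a b a b s s ≤-refl) (osc-refl (b ∷ s))

-- A sequence with fewer than two entries has no index n with n + 1 in its domain.
osc-short : ∀ s t → length t ≤ 1 → osc s t ≡ 0
osc-short [] t _ = refl
osc-short (a ∷ []) t _ = refl
osc-short (a ∷ b ∷ s) [] _ = refl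
osc-short (a ∷ b ∷ s) (c ∷ []) _ = refl
osc-short (a ∷ b ∷ s) (c ∷ d ∷ t) (s≤s ())

-- osc only looks at the common domain, so the longer argument may be truncated.
osc-++ʳ : ∀ s t u → length s ≤ length t → osc s (t ++ u) ≡ osc s t
osc-++ʳ [] t u _ = refl
osc-++ʳ (a ∷ []) t u _ = refl
osc-++ʳ (a ∷ b ∷ s) (c ∷ d ∷ t) u (s≤s (s≤s h)) =
  osc-tail-cong a b c d s (t ++ u) s t (osc-++ʳ (b ∷ s) (d ∷ t) u (s≤s h))

osc-++ˡ : ∀ s t u → length t ≤ length s → osc (s ++ u) t ≡ osc s t
osc-++ˡ s [] u _ = trans (osc-short (s ++ u) [] z≤n) (sym (osc-short s [] z≤n))
osc-++ˡ s (c ∷ []) u _ =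
  trans (osc-short (s ++ u) (c ∷ []) ≤-refl) (sym (osc-short s (c ∷ []) ≤-refl))
osc-++ˡ (a ∷ b ∷ s) (c ∷ d ∷ t) u (s≤s (s≤s h)) =
  osc-tail-cong a b c d (s ++ u) t s t (osc-++ˡ (b ∷ s) (d ∷ t) u (s≤s h))

osc-above-below : ∀ {v} s t → All (v ≤_) s → All (_< v) t → osc s t ≡ 0
osc-above-below (a ∷ b ∷ s) (c ∷ d ∷ t) (v≤a ∷ v≤b ∷ v≤s) (c<v ∷ d<v ∷ t<v) =
  trans (osc-skipˡ a b c d s t (<-≤-trans c<v v≤a))
        (osc-above-below (b ∷ s) (d ∷ t) (v≤b ∷ v≤s) (d<v ∷ t<v))
osc-above-below [] t _ _ = refl
osc-above-below (_ ∷ []) t _ _ = refl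
osc-above-below (_ ∷ _ ∷ _) [] _ _ = refl
osc-above-below (_ ∷ _ ∷ _) (_ ∷ []) _ _ = refl

osc-below-above : ∀ {v} s t → All (_< v) s → All (v ≤_) t → osc s t ≡ 0
osc-below-above (a ∷ b ∷ s) (c ∷ d ∷ t) (a<v ∷ b<v ∷ s<v) (v≤c ∷ v≤d ∷ v≤t) =
  trans (osc-skipʳ a b c d s t (<⇒≤ (<-≤-trans b<v v≤d)))
        (osc-below-above (b ∷ s) (d ∷ t) (b<v ∷ s<v) (v≤d ∷ v≤t))
osc-below-above [] t _ _ = refl
osc-below-above (_ ∷ []) t _ _ = refl
osc-below-above (_ ∷ _ ∷ _) [] _ _ = refl
osc-below-above (_ ∷ _ ∷ _) (_ ∷ []) _ _ = refl

data Aligned : List ℕ → List ℕ → Set where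
  last≤ : ∀ {a c} → a ≤ c → Aligned (a ∷ []) (c ∷ [])
  cons : ∀ {a c s t} → Aligned s t → Aligned (a ∷ s) (c ∷ t)

aligned-length : ∀ {s t} → Aligned s t → length s ≡ length t
aligned-length (last≤ _) = refl
aligned-length (cons al) = cong suc (aligned-length al)

aligned-refl : ∀ s x u → Aligned (s ++ x ∷ u) (s ++ x ∷ u)
aligned-refl [] x [] = last≤ ≤-refl
aligned-refl [] x (y ∷ u) = cons (aligned-refl [] y u)
aligned-refl (a ∷ s) x u = cons (aligned-refl s x u)

aligned-++ : ∀ s′ t′ {s t} → length s′ ≡ length t′ → Aligned s t → Aligned (s′ ++ s) (t′ ++ t)
aligned-++ [] [] _ al = al
aligned-++ (a ∷ s′) (c ∷ t′) e al = cons (aligned-++ s′ t′ (suc-injective e) al)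

aligned-separated : ∀ {v s t} → All (_< v) s → All (v ≤_) t → length s ≡ length t →
  s ≢ [] → Aligned s t
aligned-separated [] [] _ s≢[] = contradiction refl s≢[]
aligned-separated (a<v ∷ []) (v≤c ∷ []) _ _ = last≤ (<⇒≤ (<-≤-trans a<v v≤c))
aligned-separated (_ ∷ b<v ∷ s<v) (_ ∷ v≤d ∷ v≤t) e _ =
  cons (aligned-separated (b<v ∷ s<v) (v≤d ∷ v≤t) (suc-injective e) (λ ()))

osc-junction-up : ∀ {v} s t x X y Y → Aligned s t → All (v ≤_) (x ∷ X) → All (_< v) (y ∷ Y) →
  osc (s ++ x ∷ X) (t ++ y ∷ Y) ≡ suc (osc s t)
osc-junction-up (a ∷ []) (c ∷ []) x X y Y (last≤ a≤c) v≤xX@(v≤x ∷ _) yY<v@(y<v ∷ _) =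
  trans (osc-cross a x c y X Y a≤c (<-≤-trans y<v v≤x))
        (cong suc (osc-above-below (x ∷ X) (y ∷ Y) v≤xX yY<v))
osc-junction-up (a ∷ b ∷ s) (c ∷ d ∷ t) x X y Y (cons al) v≤xX yY<v =
  osc-tail-suc a b c d (s ++ x ∷ X) (t ++ y ∷ Y) s t
    (osc-junction-up (b ∷ s) (d ∷ t) x X y Y al v≤xX yY<v)

osc-junction-down : ∀ {v} s t x X y Y → length s ≡ length t →
  All (v ≤_) (x ∷ X) → All (_< v) (y ∷ Y) →
  osc (t ++ y ∷ Y) (s ++ x ∷ X) ≡ osc t s
osc-junction-down [] [] x X y Y _ v≤xX yY<v = osc-below-above (y ∷ Y) (x ∷ X) yY<v v≤xX
osc-junction-down (a ∷ []) (c ∷ []) x X y Y _ v≤xX@(v≤x ∷ _) yY<v@(y<v ∷ _) =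
  trans (osc-skipʳ c y a x Y X (<⇒≤ (<-≤-trans y<v v≤x)))
        (osc-below-above (y ∷ Y) (x ∷ X) yY<v v≤xX)
osc-junction-down (a ∷ b ∷ s) (c ∷ d ∷ t) x X y Y e v≤xX yY<v =
  osc-tail-cong c d a b (t ++ y ∷ Y) (s ++ x ∷ X) t s
    (osc-junction-down (b ∷ s) (d ∷ t) x X y Y (suc-injective e) v≤xX yY<v)

split-at : ∀ n R → n < length R →
  Σ (List ℕ) λ R₁ → Σ ℕ λ y → Σ (List ℕ) λ R₂ → R ≡ R₁ ++ y ∷ R₂ × length R₁ ≡ n
split-at zero (y ∷ R) _ = [] , y , R , refl , refl
split-at (suc n) (a ∷ R) (s≤s n<R) with split-at n R n<R
... | R₁ , y , R₂ , refl , refl = a ∷ R₁ , y , R₂ , refl , refl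

≢-longer : ∀ (s t : List ℕ) x u → length s ≡ length t → s ≢ t ++ x ∷ u
≢-longer s t x u |s|≡|t| s≡t++xu = m+1+n≢m (length t) (begin
  length t + suc (length u) ≡⟨ sym (length-++ t) ⟩
  length (t ++ x ∷ u)       ≡⟨ cong length (sym s≡t++xu) ⟩
  length s                  ≡⟨ |s|≡|t| ⟩
  length t                  ∎)

upper-bound : ∀ s → Σ ℕ λ v → All (_< v) s
upper-bound [] = 0 , []
upper-bound (a ∷ s) with upper-bound s
... | v , s<v =
  suc a ⊔ v , m≤m⊔n (suc a) v ∷ All.map (λ b<v → <-≤-trans b<v (m≤n⊔m (suc a) v)) s<v

increasing-suffix : ∀ s {t} → Increasing (s ++ t) → Increasing t
increasing-suffix [] inc = inc
increasing-suffix (a ∷ []) inc-[x] = inc-[]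
increasing-suffix (a ∷ []) (inc-∷ _ inc) = inc
increasing-suffix (a ∷ b ∷ s) (inc-∷ _ inc) = increasing-suffix (b ∷ s) inc

increasing-head-min : ∀ {x s} → Increasing (x ∷ s) → All (x ≤_) (x ∷ s)
increasing-head-min inc-[x] = ≤-refl ∷ []
increasing-head-min (inc-∷ x<y inc) =
  ≤-refl ∷ All.map (λ y≤z → ≤-trans (<⇒≤ x<y) y≤z) (increasing-head-min inc)

at-++-length : ∀ s u {y} → at (s ++ u) (length s) ≡ just y → Σ (List ℕ) λ u′ → u ≡ y ∷ u′
at-++-length [] (y ∷ u) refl = u , refl
at-++-length (a ∷ s) u e = at-++-length s u e

module Extensions (T : List ℕ → Set) (sp : Superperfect T) where

  splitting-successor : ∀ {q} → InfSplitting T q → ∀ k →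
    Σ ℕ λ y → Σ (List ℕ) λ r → k < y × T (q ++ y ∷ r) × InfSplitting T (q ++ y ∷ r)
  splitting-successor {q} split k with split k
  ... | _ , qu∈T , (u , refl) , y , qu[|q|]≡y , k<y with at-++-length q u qu[|q|]≡y
  ... | u′ , refl with sp (q ++ y ∷ u′) qu∈T
  ... | _ , ext∈T , (r , refl) , ext-splits =
    y , u′ ++ r , k<y ,
    subst T (++-assoc q (y ∷ u′) r) ext∈T ,
    subst (InfSplitting T) (++-assoc q (y ∷ u′) r) ext-splits

  long-splitting-successor : ∀ {p} → InfSplitting T p → ∀ k N →
    Σ ℕ λ x → Σ (List ℕ) λ R → k < x × N ≤ length R ×
      T (p ++ x ∷ R) × InfSplitting T (p ++ x ∷ R)
  long-splitting-successor split k zero with splitting-successor split k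
  ... | x , r , k<x , r∈T , r-splits = x , r , k<x , z≤n , r∈T , r-splits
  long-splitting-successor {p} split k (suc N) with splitting-successor split k
  ... | x , r , k<x , _ , r-splits with long-splitting-successor r-splits 0 N
  ... | y , R , _ , N≤R , R∈T , R-splits =
    x , r ++ y ∷ R , k<x , longer ,
    subst T reassoc R∈T , subst (InfSplitting T) reassoc R-splits
    where
      reassoc : (p ++ x ∷ r) ++ y ∷ R ≡ p ++ x ∷ r ++ y ∷ R
      reassoc = ++-assoc p (x ∷ r) (y ∷ R)
      longer : suc N ≤ length (r ++ y ∷ R)
      longer = subst (suc N ≤_) (sym (length-++ r))
                 (≤-trans (s≤s N≤R) (m≤n+m (suc (length R)) (length r)))

module OscillatingPairs (T : List ℕ → Set) (sub : Subtree T) (sp : Superperfect T) where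
  open Subtree sub using (increasing)
  open Extensions T sp

  -- An (i, j)-pair: ∞-splitting nodes low and high = head ++ next ∷ tail of T,
  -- where head has the length of low and is aligned with it (so high is
  -- strictly longer than low and last low ≤ high(|low| - 1)).
  record OscPair (i j : ℕ) : Set where
    field
      low head : List ℕ
      next : ℕ
      tail : List ℕ
      low∈T : T low
      high∈T : T (head ++ next ∷ tail)
      low-splits : InfSplitting T low
      high-splits : InfSplitting T (head ++ next ∷ tail)
      aligned : Aligned low head
      osc-low-high : osc low (head ++ next ∷ tail) ≡ i
      osc-high-low : osc (head ++ next ∷ tail) low ≡ j

  open OscPair

  start : T [] → OscPair 0 0
  start []∈T with sp [] []∈T
  ... | u , _ , _ , u-splits with long-splitting-successor u-splits 0 0
  ... | x , R , _ , _ , R∈T , R-splits with long-splitting-successor R-splits 0 0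
  ... | y , S , _ , _ , S∈T , S-splits = record
    { low = ℓ ; head = ℓ ; next = y ; tail = S
    ; low∈T = R∈T ; high∈T = S∈T
    ; low-splits = R-splits ; high-splits = S-splits
    ; aligned = aligned-refl u x R
    ; osc-low-high = trans (osc-++ʳ ℓ ℓ (y ∷ S) ≤-refl) (osc-refl ℓ)
    ; osc-high-low = trans (osc-++ˡ ℓ ℓ (y ∷ S) ≤-refl) (osc-refl ℓ)
    }
    where
      ℓ : List ℕ
      ℓ = u ++ x ∷ R

  step : ∀ {i j} → OscPair i j → OscPair j (suc i)
  step {i} {j} P with upper-bound (head P ++ next P ∷ tail P)
  ... | v , high<v with long-splitting-successor (low-splits P) v (suc (length (tail P)))
  ... | x , R , v<x , long , q∈T , q-splits with split-at (length (tail P)) R long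
  ... | R₁ , y , R₂ , refl , |R₁|≡|tail| = record
    { low = high ; head = low P ++ x ∷ R₁ ; next = y ; tail = R₂
    ; low∈T = high∈T P ; high∈T = subst T reassoc q∈T
    ; low-splits = high-splits P ; high-splits = subst (InfSplitting T) reassoc q-splits
    ; aligned = aligned-++ (head P) (low P) (sym |low|≡|head|)
        (aligned-separated tail<x (++⁻ˡ (x ∷ R₁) x≤R) (cong suc (sym |R₁|≡|tail|)) (λ ()))
    ; osc-low-high = begin
        osc high ((low P ++ x ∷ R₁) ++ y ∷ R₂) ≡⟨ cong (osc high) (sym reassoc) ⟩
        osc high (low P ++ x ∷ R)
          ≡⟨ osc-junction-down (low P) (head P) x R (next P) (tail P) |low|≡|head| x≤R tail<x ⟩
        osc (head P) (low P)
          ≡⟨ sym (osc-++ˡ (head P) (low P) _ (≤-reflexive |low|≡|head|)) ⟩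
        osc high (low P)                       ≡⟨ osc-high-low P ⟩
        j                                      ∎
    ; osc-high-low = begin
        osc ((low P ++ x ∷ R₁) ++ y ∷ R₂) high ≡⟨ cong (λ q → osc q high) (sym reassoc) ⟩
        osc (low P ++ x ∷ R) high
          ≡⟨ osc-junction-up (low P) (head P) x R (next P) (tail P) (aligned P) x≤R tail<x ⟩
        suc (osc (low P) (head P))
          ≡⟨ cong suc (sym (osc-++ʳ (low P) (head P) _ (≤-reflexive |low|≡|head|))) ⟩
        suc (osc (low P) high)                 ≡⟨ cong suc (osc-low-high P) ⟩
        suc i                                  ∎
    }
    where
      high : List ℕ
      high = head P ++ next P ∷ tail P
      reassoc : low P ++ x ∷ R ≡ (low P ++ x ∷ R₁) ++ y ∷ R₂
      reassoc = sym (++-assoc (low P) (x ∷ R₁) (y ∷ R₂))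
      |low|≡|head| : length (low P) ≡ length (head P)
      |low|≡|head| = aligned-length (aligned P)
      -- everything in q after low P is at least x, which exceeds all of high
      x≤R : All (x ≤_) (x ∷ R)
      x≤R = increasing-head-min (increasing-suffix (low P) (increasing _ q∈T))
      tail<x : All (_< x) (next P ∷ tail P)
      tail<x = All.map (λ z<v → <-trans z<v v<x) (++⁻ʳ (head P) high<v)

  osc-pair : T [] → ∀ k → OscPair k k
  osc-pair []∈T zero = start []∈T
  osc-pair []∈T (suc k) = step (step (osc-pair []∈T k))

  low≢high : ∀ {i j} (P : OscPair i j) → low P ≢ head P ++ next P ∷ tail P
  low≢high P = ≢-longer (low P) (head P) (next P) (tail P) (aligned-length (aligned P))

corollary3 : (T : List ℕ → Set) → Subtree T → T [] → Superperfect T →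
    (k : ℕ) → Σ (List ℕ) λ s → Σ (List ℕ) λ t →
      T s × T t × s ≢ t × osc s t ≡ k
corollary3 T sub []∈T sp k =
  low P , head P ++ next P ∷ tail P , low∈T P , high∈T P , low≢high P , osc-low-high P
  where
    open OscillatingPairs T sub sp
    open OscPair
    P : OscPair k k
    P = osc-pair []∈T k
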